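{- Let $k\geq 2$ and $n$ be positive integers and let $a_1<a_2<\cdots<a_k$ be positive integers satisfying $\frac{n}{2^{n}}=\sum_{i=1}^{k}\frac{a_{i}}{2^{a_{i}}}$. Then $$a_k\leq 2n+2k\log_2 k.$$
   Context: The equation $\frac{n}{2^{n}}=\sum_{i=1}^{k}\frac{a_{i}}{2^{a_{i}}}$ is considered in positive integers $n,k,a_1,\ldots,a_k$ with $k\geq 2$ and $a_1<\cdots<a_k$. -}

module Defs where

open import Data.Nat using (ℕ; zero; suc; _+_; _*_; _∸_; _^_)
open import Data.Fin using (Fin; zero; suc)

ΣFin : (k : ℕ) → (Fin k → ℕ) → ℕ
ΣFin zero    f = 0
ΣFin (suc k) f = f zero + ΣFin k (λ i → f (suc i))

open import Data.Nat using (_≤_; _<_; s≤s; z≤n)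

k∸1<k : ∀ {k} → 2 ≤ k → k ∸ 1 < k
k∸1<k {suc (suc k)} (s≤s (s≤s _)) = s≤s (s≤s (Data.Nat.Properties.≤-refl {k}))
  where import Data.Nat.Properties

{-# OPTIONS --safe #-}
-- Write A = aₖ and S = Σ aᵢ 2^(A − aᵢ); the equation reads n 2^A = 2^n S, so 2^A ∣ 2^n S.
-- Terms with aᵢ ≤ n are themselves divisible by 2^A after the factor 2^n and can be dropped.
-- Once n < a₁, divisibility by 2^A passes to 2^{a₁} times the tail sum S′, so S′ ≥ 2^(A − a₁)
-- and the head term a₁ 2^(A − a₁) is at most a₁ S′; hence S ≤ A S′ and inductively
-- 2^A ≤ 2^n A^k. Squaring gives 2^(2A) ≤ 2^(2n) A^(2k), and A^(2k) ≤ 2^A k^(2k) once A ≥ 4k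
-- (from (B + 1)^m ≤ 2 B^m for 2m ≤ B + 1); the cases A < 4k are checked directly.
module Submission where

open import Defs
open import Data.Nat
  using (ℕ; zero; suc; _+_; _*_; _∸_; _^_; _≤_; _<_; z≤n; s≤s; s≤s⁻¹; _≤?_; >-nonZero)
open import Data.Nat.Properties
open import Data.Nat.Divisibility
  using (_∣_; divides; ∣⇒≤; ∣-trans; ∣m+n∣m⇒∣n; n∣m*n; *-pres-∣; *-monoˡ-∣)
open import Data.Nat.Tactic.RingSolver using (solve-∀)
open import Algebra.Properties.CommutativeSemigroup *-commutativeSemigroup
  using (interchange; x∙yz≈y∙xz)
open import Data.Fin using (Fin; fromℕ; fromℕ<)
open import Data.Fin as F using ()
open import Data.Fin.Properties using (fromℕ-def)
open import Data.Empty using (⊥-elim)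
open import Function using (_∘_)
open import Relation.Binary.Core using (_Preserves_⟶_)
open import Relation.Binary.PropositionalEquality
  using (_≡_; refl; sym; trans; cong; cong₂; subst)
open import Relation.Nullary using (yes; no)

open ≤-Reasoning

m^n*m^[o∸n]≡m^o : ∀ m {n o} → n ≤ o → m ^ n * m ^ (o ∸ n) ≡ m ^ o
m^n*m^[o∸n]≡m^o m {n} {o} n≤o =
  trans (sym (^-distribˡ-+-* m n (o ∸ n))) (cong (m ^_) (m+[n∸m]≡n n≤o))

m^n∣m^o : ∀ m {n o} → n ≤ o → m ^ n ∣ m ^ o
m^n∣m^o m {n} {o} n≤o =
  divides (m ^ (o ∸ n)) (trans (sym (m^n*m^[o∸n]≡m^o m n≤o)) (*-comm (m ^ n) (m ^ (o ∸ n))))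

m^[2*n]≡m^n*m^n : ∀ m n → m ^ (2 * n) ≡ m ^ n * m ^ n
m^[2*n]≡m^n*m^n m n = trans (cong (λ e → m ^ (n + e)) (+-identityʳ n)) (^-distribˡ-+-* m n n)

^-distrib-* : ∀ m n o → (m * n) ^ o ≡ m ^ o * n ^ o
^-distrib-* m n zero    = refl
^-distrib-* m n (suc o) =
  trans (cong (m * n *_) (^-distrib-* m n o)) (interchange m n (m ^ o) (n ^ o))

∣m*[n+o]∣m*n⇒∣m*o : ∀ m {d n o} → d ∣ m * (n + o) → d ∣ m * n → d ∣ m * o
∣m*[n+o]∣m*n⇒∣m*o m {d} {n} {o} d∣m*[n+o] = ∣m+n∣m⇒∣n (subst (d ∣_) (*-distribˡ-+ m n o) d∣m*[n+o])

∣⇒≤-pos : ∀ {m n} → 0 < n → m ∣ n → m ≤ n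
∣⇒≤-pos 0<n = ∣⇒≤ {{>-nonZero 0<n}}

-- 2^A Σ bᵢ / 2^bᵢ when every bᵢ ≤ A (otherwise ∸ truncates).
weightedSum : ∀ {r} → ℕ → (Fin r → ℕ) → ℕ
weightedSum {r} A b = ΣFin r (λ i → b i * 2 ^ (A ∸ b i))

2^A∣2^t*[x*2^[A∸x]] : ∀ A {t x} → x ≤ t → x ≤ A → 2 ^ A ∣ 2 ^ t * (x * 2 ^ (A ∸ x))
2^A∣2^t*[x*2^[A∸x]] A {t} {x} x≤t x≤A =
  subst (_∣ 2 ^ t * (x * 2 ^ (A ∸ x))) (m^n*m^[o∸n]≡m^o 2 x≤A) (*-pres-∣ (m^n∣m^o 2 x≤t) (n∣m*n x))

record IsChain {r} (A : ℕ) (b : Fin (suc r) → ℕ) : Set where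
  field
    positive   : ∀ i → 1 ≤ b i
    increasing : b Preserves F._<_ ⟶ _<_
    last≡      : b (fromℕ r) ≡ A

open IsChain

module _ {A : ℕ} where

  tail : ∀ {r} {b : Fin (suc (suc r)) → ℕ} → IsChain A b → IsChain A (b ∘ F.suc)
  tail c = record
    { positive   = positive c ∘ F.suc
    ; increasing = λ i<j → increasing c (s≤s i<j)
    ; last≡      = last≡ c
    }

  head<last : ∀ {r} {b : Fin (suc (suc r)) → ℕ} → IsChain A b → b F.zero < A
  head<last c = subst (_ <_) (last≡ c) (increasing c (s≤s z≤n))

  last>0 : ∀ {r} {b : Fin (suc r) → ℕ} → IsChain A b → 0 < A
  last>0 {r} c = subst (0 <_) (last≡ c) (positive c (fromℕ r))

  weightedSum>0 : ∀ {r} {b : Fin (suc r) → ℕ} → IsChain A b → 0 < weightedSum A b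
  weightedSum>0 {b = b} c =
    ≤-trans (*-mono-≤ (positive c F.zero) (m^n>0 2 (A ∸ b F.zero))) (m≤m+n _ _)

  weightedSum≤last^length : ∀ r {b : Fin (suc r) → ℕ} → IsChain A b →
    2 ^ A ∣ 2 ^ b F.zero * weightedSum A b → weightedSum A b ≤ A ^ suc r
  weightedSum≤last^length zero c _ rewrite last≡ c | n∸n≡0 A = ≤-reflexive (+-identityʳ (A * 1))
  weightedSum≤last^length (suc r) {b} c d = begin
    b₀ * 2 ^ (A ∸ b₀) + S  ≤⟨ +-monoˡ-≤ S (*-monoʳ-≤ b₀ 2^[A∸b₀]≤S) ⟩
    b₀ * S + S            ≡⟨ +-comm (b₀ * S) S ⟩
    suc b₀ * S            ≤⟨ *-mono-≤ (head<last c) S≤A^r ⟩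
    A * A ^ suc r         ∎
    where
    b₀ S : ℕ
    b₀ = b F.zero
    S = weightedSum A (b ∘ F.suc)
    b₀≤A : b₀ ≤ A
    b₀≤A = <⇒≤ (head<last c)
    2^A∣2^b₀*S : 2 ^ A ∣ 2 ^ b₀ * S
    2^A∣2^b₀*S = ∣m*[n+o]∣m*n⇒∣m*o (2 ^ b₀) d (2^A∣2^t*[x*2^[A∸x]] A ≤-refl b₀≤A)
    S≤A^r : S ≤ A ^ suc r
    S≤A^r = weightedSum≤last^length r (tail c)
      (∣-trans 2^A∣2^b₀*S (*-monoˡ-∣ S (m^n∣m^o 2 (<⇒≤ (increasing c (s≤s z≤n))))))
    2^[A∸b₀]≤S : 2 ^ (A ∸ b₀) ≤ S
    2^[A∸b₀]≤S = *-cancelˡ-≤ {2 ^ (A ∸ b₀)} {S} (2 ^ b₀) {{m^n≢0 2 b₀}} (begin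
      2 ^ b₀ * 2 ^ (A ∸ b₀) ≡⟨ m^n*m^[o∸n]≡m^o 2 b₀≤A ⟩
      2 ^ A                 ≤⟨ ∣⇒≤-pos (*-mono-≤ (m^n>0 2 b₀) (weightedSum>0 (tail c))) 2^A∣2^b₀*S ⟩
      2 ^ b₀ * S            ∎)

  2^last≤2^t*last^length : ∀ r {b : Fin (suc r) → ℕ} t → IsChain A b →
    2 ^ A ∣ 2 ^ t * weightedSum A b → 2 ^ A ≤ 2 ^ t * A ^ suc r
  2^last≤2^t*last^length r {b} t c d with b F.zero ≤? t
  ... | no b₀≰t = begin
    2 ^ A                  ≤⟨ ∣⇒≤-pos (*-mono-≤ (m^n>0 2 t) (weightedSum>0 c)) d ⟩
    2 ^ t * weightedSum A b ≤⟨ *-monoʳ-≤ (2 ^ t) (weightedSum≤last^length r c 2^A∣2^b₀*S) ⟩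
    2 ^ t * A ^ suc r       ∎
    where
    2^A∣2^b₀*S : 2 ^ A ∣ 2 ^ b F.zero * weightedSum A b
    2^A∣2^b₀*S = ∣-trans d (*-monoˡ-∣ (weightedSum A b) (m^n∣m^o 2 (<⇒≤ (≰⇒> b₀≰t))))
  2^last≤2^t*last^length zero t c d | yes b₀≤t = begin
    2 ^ A     ≤⟨ ^-monoʳ-≤ 2 (subst (_≤ t) (last≡ c) b₀≤t) ⟩
    2 ^ t     ≤⟨ m≤m*n (2 ^ t) (A ^ 1) {{>-nonZero (^-monoˡ-≤ 1 (last>0 c))}} ⟩
    2 ^ t * A ^ 1 ∎
  2^last≤2^t*last^length (suc r) {b} t c d | yes b₀≤t = begin
    2 ^ A             ≤⟨ 2^last≤2^t*last^length r t (tail c) 2^A∣2^t*tail ⟩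
    2 ^ t * A ^ suc r ≤⟨ *-monoʳ-≤ (2 ^ t) (m≤n*m (A ^ suc r) A {{>-nonZero (last>0 c)}}) ⟩
    2 ^ t * A ^ suc (suc r) ∎
    where
    2^A∣2^t*tail : 2 ^ A ∣ 2 ^ t * weightedSum A (b ∘ F.suc)
    2^A∣2^t*tail = ∣m*[n+o]∣m*n⇒∣m*o (2 ^ t) d (2^A∣2^t*[x*2^[A∸x]] A b₀≤t (<⇒≤ (head<last c)))

-- (a + 1)^m − a^m ≤ m (a + 1)^(m − 1), multiplied by a + 1 so that no subtraction occurs.
^-increment-≤ : ∀ a m → suc a ^ suc m ≤ suc a * a ^ m + m * suc a ^ m
^-increment-≤ a zero    = m≤m+n (suc a * 1) 0
^-increment-≤ a (suc m) = begin
  x * x ^ suc m                 ≤⟨ *-monoʳ-≤ x (^-increment-≤ a m) ⟩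
  x * (x * p + m * q)           ≡⟨ expand a p q m ⟩
  x * (a * p) + x * p + m * (x * q) ≤⟨ +-monoˡ-≤ _ (+-monoʳ-≤ (x * (a * p)) (*-monoʳ-≤ x p≤q)) ⟩
  x * (a * p) + x * q + m * (x * q) ≡⟨ +-assoc (x * (a * p)) (x * q) (m * (x * q)) ⟩
  x * (a * p) + suc m * (x * q) ∎
  where
  x p q : ℕ
  x = suc a
  p = a ^ m
  q = x ^ m
  p≤q : p ≤ q
  p≤q = ^-monoˡ-≤ m (n≤1+n a)
  expand : ∀ a p q m →
    (1 + a) * ((1 + a) * p + m * q) ≡ (1 + a) * (a * p) + (1 + a) * p + m * ((1 + a) * q)
  expand = solve-∀

suc^≤2*^ : ∀ a m → 2 * m ≤ suc a → suc a ^ m ≤ 2 * a ^ m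
suc^≤2*^ a m 2m≤x = *-cancelˡ-≤ {q} {2 * p} x (+-cancelʳ-≤ (x * q) (x * q) (x * (2 * p)) (begin
  x * q + x * q           ≡⟨ double x q ⟩
  2 * (x * q)             ≤⟨ *-monoʳ-≤ 2 (^-increment-≤ a m) ⟩
  2 * (x * p + m * q)     ≡⟨ regroup x p q m ⟩
  x * (2 * p) + 2 * m * q ≤⟨ +-monoʳ-≤ (x * (2 * p)) (*-monoˡ-≤ q 2m≤x) ⟩
  x * (2 * p) + x * q     ∎))
  where
  x p q : ℕ
  x = suc a
  p = a ^ m
  q = x ^ m
  double : ∀ x q → x * q + x * q ≡ 2 * (x * q)
  double = solve-∀
  regroup : ∀ x p q m → 2 * (x * p + m * q) ≡ x * (2 * p) + 2 * m * q
  regroup = solve-∀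

A^[2k]≤2^A*k^[2k] : ∀ k {A} → 4 * k ≤ A → A ^ (2 * k) ≤ 2 ^ A * k ^ (2 * k)
A^[2k]≤2^A*k^[2k] k 4k≤A = subst (λ A → A ^ (2 * k) ≤ 2 ^ A * K) (m+[n∸m]≡n 4k≤A) (above-4k _)
  where
  K : ℕ
  K = k ^ (2 * k)
  above-4k : ∀ d → (4 * k + d) ^ (2 * k) ≤ 2 ^ (4 * k + d) * K
  above-4k zero rewrite +-identityʳ (4 * k) = ≤-reflexive (begin-equality
    (4 * k) ^ (2 * k)       ≡⟨ ^-distrib-* 4 k (2 * k) ⟩
    (2 ^ 2) ^ (2 * k) * K   ≡⟨ cong (_* K) (^-*-assoc 2 2 (2 * k)) ⟩
    2 ^ (2 * (2 * k)) * K   ≡⟨ cong (λ e → 2 ^ e * K) (sym (*-assoc 2 2 k)) ⟩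
    2 ^ (4 * k) * K         ∎)
  above-4k (suc d) rewrite +-suc (4 * k) d = begin
    suc B ^ (2 * k)  ≤⟨ suc^≤2*^ B (2 * k) 2*[2k]≤1+B ⟩
    2 * B ^ (2 * k)  ≤⟨ *-monoʳ-≤ 2 (above-4k d) ⟩
    2 * (2 ^ B * K)  ≡⟨ *-assoc 2 (2 ^ B) K ⟨
    2 ^ suc B * K    ∎
    where
    B : ℕ
    B = 4 * k + d
    2*[2k]≤1+B : 2 * (2 * k) ≤ suc B
    2*[2k]≤1+B = ≤-trans (≤-reflexive (sym (*-assoc 2 2 k))) (≤-trans (m≤m+n (4 * k) d) (n≤1+n B))

2^[4k]≤k^[2k] : ∀ k → 4 ≤ k → 2 ^ (4 * k) ≤ k ^ (2 * k)
2^[4k]≤k^[2k] k 4≤k = begin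
  2 ^ (4 * k)  ≡⟨ ^-*-assoc 2 4 k ⟨
  (4 ^ 2) ^ k  ≤⟨ ^-monoˡ-≤ k {4 ^ 2} {k ^ 2} (^-monoˡ-≤ 2 4≤k) ⟩
  (k ^ 2) ^ k  ≡⟨ ^-*-assoc k 2 k ⟩
  k ^ (2 * k)  ∎

2^A≤2^[2n]*k^[2k]-large : ∀ n k A → 4 * k ≤ A → 2 ^ A ≤ 2 ^ n * A ^ k →
  2 ^ A ≤ 2 ^ (2 * n) * k ^ (2 * k)
2^A≤2^[2n]*k^[2k]-large n k A 4k≤A 2^A≤2^n*A^k =
  *-cancelˡ-≤ {2 ^ A} {N * K} (2 ^ A) {{m^n≢0 2 A}} (begin
  2 ^ A * 2 ^ A                     ≤⟨ *-mono-≤ 2^A≤2^n*A^k 2^A≤2^n*A^k ⟩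
  (2 ^ n * A ^ k) * (2 ^ n * A ^ k) ≡⟨ interchange (2 ^ n) (A ^ k) (2 ^ n) (A ^ k) ⟩
  (2 ^ n * 2 ^ n) * (A ^ k * A ^ k) ≡⟨ cong₂ _*_ (m^[2*n]≡m^n*m^n 2 n) (m^[2*n]≡m^n*m^n A k) ⟨
  N * A ^ (2 * k)                   ≤⟨ *-monoʳ-≤ N (A^[2k]≤2^A*k^[2k] k 4k≤A) ⟩
  N * (2 ^ A * K)                   ≡⟨ x∙yz≈y∙xz N (2 ^ A) K ⟩
  2 ^ A * (N * K)                   ∎)
  where
  N K : ℕ
  N = 2 ^ (2 * n)
  K = k ^ (2 * k)

2^A≤2^[2n]*k^[2k]-small : ∀ n k A → 2 ≤ k → 1 ≤ n → A < 4 * k → 2 ^ A ≤ 2 ^ n * A ^ k →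
  2 ^ A ≤ 2 ^ (2 * n) * k ^ (2 * k)
2^A≤2^[2n]*k^[2k]-small _ 0 _ ()
2^A≤2^[2n]*k^[2k]-small _ 1 _ (s≤s ())
2^A≤2^[2n]*k^[2k]-small 0 2 _ _ ()
-- For k = 2 and n = 1, A < 8 alone is not enough: A = 7 is excluded by 2^7 > 2 · 7^2.
2^A≤2^[2n]*k^[2k]-small 1 2 A _ _ A<8 2^A≤2*A^2 with A ≤? 6
... | yes A≤6 = ^-monoʳ-≤ 2 A≤6
... | no A≰6 = ⊥-elim (<⇒≱ (≤ᵇ⇒≤ 99 128 _) (subst (λ A → 2 ^ A ≤ 2 ^ 1 * A ^ 2) A≡7 2^A≤2*A^2))
  where
  A≡7 : A ≡ 7
  A≡7 = ≤-antisym (s≤s⁻¹ A<8) (≰⇒> A≰6)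
2^A≤2^[2n]*k^[2k]-small (suc (suc n)) 2 A _ _ A<8 _ = begin
  2 ^ A                   ≤⟨ ^-monoʳ-≤ 2 (s≤s⁻¹ A<8) ⟩
  2 ^ 7                   ≤⟨ ≤ᵇ⇒≤ 128 256 _ ⟩
  2 ^ 4 * 16              ≤⟨ *-monoˡ-≤ 16 (^-monoʳ-≤ 2 {4} {2 * suc (suc n)} 4≤2*[2+n]) ⟩
  2 ^ (2 * suc (suc n)) * 16 ∎
  where
  4≤2*[2+n] : 4 ≤ 2 * suc (suc n)
  4≤2*[2+n] = *-monoʳ-≤ 2 (s≤s (s≤s z≤n))
2^A≤2^[2n]*k^[2k]-small n 3 A _ 1≤n A<12 _ = begin
  2 ^ A                 ≤⟨ ^-monoʳ-≤ 2 (s≤s⁻¹ A<12) ⟩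
  2 ^ 11                ≤⟨ ≤ᵇ⇒≤ 2048 2916 _ ⟩
  2 ^ 2 * 729           ≤⟨ *-monoˡ-≤ 729 (^-monoʳ-≤ 2 (*-monoʳ-≤ 2 1≤n)) ⟩
  2 ^ (2 * n) * 729     ∎
2^A≤2^[2n]*k^[2k]-small n k@(suc (suc (suc (suc _)))) A _ _ A<4k _ = begin
  2 ^ A                     ≤⟨ ^-monoʳ-≤ 2 (<⇒≤ A<4k) ⟩
  2 ^ (4 * k)               ≤⟨ 2^[4k]≤k^[2k] k (s≤s (s≤s (s≤s (s≤s z≤n)))) ⟩
  k ^ (2 * k)               ≤⟨ m≤n*m (k ^ (2 * k)) (2 ^ (2 * n)) {{m^n≢0 2 (2 * n)}} ⟩
  2 ^ (2 * n) * k ^ (2 * k) ∎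

2^A≤2^[2n]*k^[2k] : ∀ n k A → 2 ≤ k → 1 ≤ n → 2 ^ A ≤ 2 ^ n * A ^ k →
  2 ^ A ≤ 2 ^ (2 * n) * k ^ (2 * k)
2^A≤2^[2n]*k^[2k] n k A 2≤k 1≤n with 4 * k ≤? A
... | yes 4k≤A = 2^A≤2^[2n]*k^[2k]-large n k A 4k≤A
... | no 4k≰A = 2^A≤2^[2n]*k^[2k]-small n k A 2≤k 1≤n (≰⇒> 4k≰A)

theorem2p8 : (n k : ℕ) (a : Fin k → ℕ) (k≥2 : 2 ≤ k) → 1 ≤ n →
    (∀ i → 1 ≤ a i) →
    (∀ i j → i F.< j → a i < a j) →
    let aₖ = a (fromℕ< {k ∸ 1} (k∸1<k k≥2)) in
    n * 2 ^ aₖ ≡ 2 ^ n * ΣFin k (λ i → a i * 2 ^ (aₖ ∸ a i)) →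
    2 ^ aₖ ≤ 2 ^ (2 * n) * k ^ (2 * k)
theorem2p8 _ 1 _ (s≤s ())
theorem2p8 n (suc (suc k)) a k≥2 n≥1 a>0 a-increasing n*2^aₖ≡2^n*S =
  2^A≤2^[2n]*k^[2k] n (suc (suc k)) aₖ k≥2 n≥1
    (2^last≤2^t*last^length {aₖ} (suc k) n chain (divides n (sym n*2^aₖ≡2^n*S)))
  where
  aₖ : ℕ
  aₖ = a (fromℕ< (k∸1<k k≥2))
  chain : IsChain aₖ a
  chain = record
    { positive   = a>0
    ; increasing = λ {i} {j} → a-increasing i j
    ; last≡      = cong a (fromℕ-def (suc k))
    }
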